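{- Let $G$ be a graph and let $d$ be a positive integer such that $d$ divides $d_G(v)$ for every $v\in V(G)$ and $d$ does not divide $|E(G)|$. Then for every positive integer $k$, $G$ has no cyclic interval $dk$-coloring.
   Context: All graphs are finite and undirected; multiple edges are allowed, loops are not. A proper $t$-edge coloring of $G$ is a map $\alpha:E(G)\to\{1,\dots,t\}$ with $\alpha(e)\neq\alpha(e')$ for adjacent edges $e,e'$; $S(v,\alpha)$ is the set of colors on edges incident to $v$. A proper $t$-edge coloring $\alpha$ is a cyclic interval $t$-coloring if for every vertex $v$, either $S(v,\alpha)$ or $\{1,\dots,t\}\setminus S(v,\alpha)$ is a set of consecutive integers. -}

module Defs where

open import Data.Nat using (ℕ; _≤_; _<_)
open import Data.Fin using (Fin; toℕ; _≟_)
open import Data.List using (List; length; filter)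
open import Data.Fin.Base using ()
open import Data.List using () renaming (_∷_ to _∷ₗ_)
open import Data.Vec.Functional using ()
open import Data.Product using (Σ; ∃; _×_; _,_)
open import Data.Sum using (_⊎_)
open import Relation.Nullary using (¬_)
open import Relation.Nullary.Decidable using (_⊎-dec_)
open import Relation.Binary.PropositionalEquality using (_≡_; _≢_)
open import Function.Bundles using (_⇔_)
import Data.List as L

record Graph : Set where
  field
    n     : ℕ
    m     : ℕ
    end₁  : Fin m → Fin n
    end₂  : Fin m → Fin n
    loopless : ∀ e → end₁ e ≢ end₂ e

open Graph public

V : Graph → Set
V G = Fin (n G)

E : Graph → Set
E G = Fin (m G)

edgeCount : Graph → ℕ
edgeCount G = m G

Incident : (G : Graph) → E G → V G → Set
Incident G e v = (end₁ G e ≡ v) ⊎ (end₂ G e ≡ v)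

Adjacent : (G : Graph) → E G → E G → Set
Adjacent G e e' = e ≢ e' × ∃ λ v → Incident G e v × Incident G e' v

degree : (G : Graph) → V G → ℕ
degree G v = length (filter (λ e → (end₁ G e ≟ v) ⊎-dec (end₂ G e ≟ v)) (L.allFin (m G)))

-- An edge coloring with t colors; color c : Fin t stands for toℕ c + 1 ∈ {1,…,t}.
EdgeColoring : Graph → ℕ → Set
EdgeColoring G t = E G → Fin t

Proper : (G : Graph) (t : ℕ) → EdgeColoring G t → Set
Proper G t α = ∀ e e' → Adjacent G e e' → α e ≢ α e'

InS : (G : Graph) (t : ℕ) → EdgeColoring G t → V G → Fin t → Set
InS G t α v c = ∃ λ e → Incident G e v × α e ≡ c

Consecutive : (t : ℕ) → (Fin t → Set) → Set
Consecutive t X = ∃ λ a → ∃ λ b → ∀ c → X c ⇔ (a ≤ toℕ c × toℕ c < b)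

CyclicInterval : (G : Graph) (t : ℕ) → EdgeColoring G t → Set
CyclicInterval G t α =
  Proper G t α ×
  (∀ v → Consecutive t (InS G t α v) ⊎ Consecutive t (λ c → ¬ InS G t α v c))

-- Let t = d k and call a colour a multiple colour if its number (counted from 0) is
-- divisible by d.  At a vertex v the colours form an interval or the complement of an
-- interval in {0,…,t−1}; since d divides both t and d_G(v), that interval (or its
-- complement) has length divisible by d, and a run of l·d consecutive integers contains
-- exactly l multiples of d.  Hence exactly d_G(v)/d edges at v carry a multiple colour.
-- Summing over v counts every such edge twice, so d · #{edges with a multiple colour}
-- = |E(G)|, contradicting d ∤ |E(G)|.
module Submission where

open import Defs
open import Data.Nat using (ℕ; zero; suc; _+_; _*_; _∸_; _⊓_; _≤_; _<_; NonZero; s≤s; s≤s⁻¹; s<s)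
open import Data.Nat.Properties
  using (_≤?_; _<?_; +-identityʳ; +-comm; +-assoc; +-suc; *-identityʳ; *-comm; *-assoc;
         *-distribˡ-+; *-distribʳ-+; +-cancelˡ-≡; *-cancelˡ-≡; <-irrefl; <-≤-trans;
         +-*-semiring; *-commutativeSemigroup)
open import Algebra.Properties.CommutativeSemigroup *-commutativeSemigroup using () renaming (x∙yz≈y∙xz to x*yz≡y*xz)
open import Data.Nat.Divisibility
  using (_∣_; divides; _∣?_; _∣0; ∣-refl; ∣⇒≤; ∣m∣n⇒∣m+n; ∣m+n∣m⇒∣n)
open import Data.Fin using (Fin; zero; suc; toℕ; _≟_)
open import Data.Fin.Properties using (toℕ<n; suc-injective; any?)
open import Data.List using (length; filter; tabulate)
open import Data.Bool using (true; false; if_then_else_)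
open import Level using (Level)
open import Data.Product using (∃; _×_; _,_)
open import Data.Sum using (inj₁; inj₂)
open import Data.Empty using (⊥-elim)
open import Function using (_∘_; _⇔_; mk⇔)
import Function.Properties.Equivalence as ⇔
open import Relation.Nullary using (¬_; Dec; yes; no; does)
open import Relation.Nullary.Decidable using (_×-dec_; _⊎-dec_; ¬?; does-⇔)
open import Relation.Unary using (Decidable)
open import Relation.Binary.PropositionalEquality
  using (_≡_; refl; sym; trans; cong; cong₂; subst; module ≡-Reasoning)
open import Algebra.Properties.Semiring.Sum +-*-semiring
  using (sum-syntax; sum-cong-≗; sum-replicate-zero; ∑-distrib-+; ∑-comm; *-distribˡ-sum; *-distribʳ-sum)

open ≡-Reasoning

private
  variable
    p q : Level
    P : Set p
    Q : Set q

𝟙 : Dec P → ℕ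
𝟙 P? = if does P? then 1 else 0

𝟙-⇔ : P ⇔ Q → (P? : Dec P) (Q? : Dec Q) → 𝟙 P? ≡ 𝟙 Q?
𝟙-⇔ P⇔Q P? Q? = cong (λ b → if b then 1 else 0) (does-⇔ P⇔Q P? Q?)

𝟙-yes : (P? : Dec P) → P → 𝟙 P? ≡ 1
𝟙-yes (yes _) _ = refl
𝟙-yes (no ¬p) p = ⊥-elim (¬p p)

𝟙-no : (P? : Dec P) → ¬ P → 𝟙 P? ≡ 0
𝟙-no (yes p) ¬p = ⊥-elim (¬p p)
𝟙-no (no _)  _  = refl

𝟙-× : (P? : Dec P) (Q? : Dec Q) → 𝟙 (P? ×-dec Q?) ≡ 𝟙 P? * 𝟙 Q?
𝟙-× (yes _) (yes _) = refl
𝟙-× (yes _) (no _)  = refl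
𝟙-× (no _)  _       = refl

𝟙-⊎-disjoint : ¬ (P × Q) → (P? : Dec P) (Q? : Dec Q) → 𝟙 (P? ⊎-dec Q?) ≡ 𝟙 P? + 𝟙 Q?
𝟙-⊎-disjoint disj (yes p) (yes q) = ⊥-elim (disj (p , q))
𝟙-⊎-disjoint disj (yes _) (no _)  = refl
𝟙-⊎-disjoint disj (no _)  (yes _) = refl
𝟙-⊎-disjoint disj (no _)  (no _)  = refl

𝟙-¬ : (P? : Dec P) → 𝟙 P? + 𝟙 (¬? P?) ≡ 1
𝟙-¬ (yes _) = refl
𝟙-¬ (no _)  = refl

∑-const-1 : ∀ n → ∑[ i < n ] 1 ≡ n
∑-const-1 zero    = refl
∑-const-1 (suc n) = cong suc (∑-const-1 n)

∑-δ : ∀ {n} (i : Fin n) (f : Fin n → ℕ) → ∑[ j < n ] (𝟙 (i ≟ j) * f j) ≡ f i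
∑-δ {suc n} zero    f = trans (cong₂ _+_ (+-identityʳ (f zero)) (sum-replicate-zero n)) (+-identityʳ (f zero))
∑-δ {suc n} (suc i) f = ∑-δ i (f ∘ suc)

∑-𝟙-unique : ∀ {n} {P : Fin n → Set p} (P? : Decidable P) → (∀ i j → P i → P j → i ≡ j) →
             ∑[ i < n ] 𝟙 (P? i) ≡ 𝟙 (any? P?)
∑-𝟙-unique {n = zero}  P? unique = refl
∑-𝟙-unique {n = suc n} {P} P? unique
  with P? zero | ∑-𝟙-unique (P? ∘ suc) (λ i j pi pj → suc-injective (unique (suc i) (suc j) pi pj))
... | yes p | ∑tail = cong suc (trans ∑tail (𝟙-no (any? (P? ∘ suc)) none))
  where
  none : ¬ ∃ (P ∘ suc)
  none (i , pi) with () ← unique zero (suc i) p pi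
... | no _  | ∑tail = ∑tail

∑-fibres : ∀ {m n} (f : Fin m → Fin n) (w : Fin m → ℕ) (h : Fin n → ℕ) →
           ∑[ i < m ] (w i * h (f i)) ≡ ∑[ j < n ] (∑[ i < m ] (w i * 𝟙 (f i ≟ j)) * h j)
∑-fibres {m} {n} f w h = begin
  ∑[ i < m ] (w i * h (f i))
    ≡⟨ sum-cong-≗ {m} (λ i → cong (w i *_) (sym (∑-δ (f i) h))) ⟩
  ∑[ i < m ] (w i * ∑[ j < n ] (𝟙 (f i ≟ j) * h j))
    ≡⟨ sum-cong-≗ {m} (λ i → *-distribˡ-sum (w i) (λ j → 𝟙 (f i ≟ j) * h j)) ⟩
  ∑[ i < m ] ∑[ j < n ] (w i * (𝟙 (f i ≟ j) * h j))
    ≡⟨ ∑-comm (λ i j → w i * (𝟙 (f i ≟ j) * h j)) ⟩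
  ∑[ j < n ] ∑[ i < m ] (w i * (𝟙 (f i ≟ j) * h j))
    ≡⟨ sum-cong-≗ {n} (λ j → sum-cong-≗ {m} (λ i → sym (*-assoc (w i) _ (h j)))) ⟩
  ∑[ j < n ] ∑[ i < m ] (w i * 𝟙 (f i ≟ j) * h j)
    ≡⟨ sum-cong-≗ {n} (λ j → sym (*-distribʳ-sum (h j) (λ i → w i * 𝟙 (f i ≟ j)))) ⟩
  ∑[ j < n ] (∑[ i < m ] (w i * 𝟙 (f i ≟ j)) * h j) ∎

length-filter-tabulate : ∀ {A : Set} {P : A → Set p} (P? : Decidable P) n (f : Fin n → A) →
                         length (filter P? (tabulate f)) ≡ ∑[ i < n ] 𝟙 (P? (f i))
length-filter-tabulate P? zero    f = refl
length-filter-tabulate P? (suc n) f with does (P? (f zero))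
... | true  = cong suc (length-filter-tabulate P? n (f ∘ suc))
... | false = length-filter-tabulate P? n (f ∘ suc)

sumℕ-syntax : ℕ → (ℕ → ℕ) → ℕ
sumℕ-syntax n g = ∑[ i < n ] g (toℕ i)

syntax sumℕ-syntax n (λ i → x) = ∑ℕ[ i < n ] x

∑ℕ-cong< : ∀ n {f g : ℕ → ℕ} → (∀ i → i < n → f i ≡ g i) → ∑ℕ[ i < n ] f i ≡ ∑ℕ[ i < n ] g i
∑ℕ-cong< n f≡g = sum-cong-≗ {n} (λ i → f≡g (toℕ i) (toℕ<n i))

∑ℕ-+ : ∀ m n (g : ℕ → ℕ) → ∑ℕ[ i < m + n ] g i ≡ ∑ℕ[ i < m ] g i + ∑ℕ[ i < n ] g (m + i)
∑ℕ-+ zero    n g = refl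
∑ℕ-+ (suc m) n g = trans (cong (g 0 +_) (∑ℕ-+ m n (g ∘ suc))) (sym (+-assoc (g 0) _ _))

∑ℕ-snoc : ∀ n (g : ℕ → ℕ) → ∑ℕ[ i < suc n ] g i ≡ ∑ℕ[ i < n ] g i + g n
∑ℕ-snoc zero    g = +-identityʳ (g 0)
∑ℕ-snoc (suc n) g = trans (cong (g 0 +_) (∑ℕ-snoc n (g ∘ suc))) (sym (+-assoc (g 0) _ _))

∑ℕ-below : ∀ b t (g : ℕ → ℕ) → ∑ℕ[ i < t ] (𝟙 (i <? b) * g i) ≡ ∑ℕ[ i < b ⊓ t ] g i
∑ℕ-below zero    t       g = sum-replicate-zero t
∑ℕ-below (suc b) zero    g = refl
∑ℕ-below (suc b) (suc t) g = cong₂ _+_ (+-identityʳ (g 0)) (∑ℕ-below b t (g ∘ suc))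

∑ℕ-from : ∀ a t (g : ℕ → ℕ) → ∑ℕ[ i < t ] (𝟙 (a ≤? i) * g i) ≡ ∑ℕ[ i < t ∸ a ] g (a + i)
∑ℕ-from zero    t       g = sum-cong-≗ {t} (λ i → +-identityʳ (g (toℕ i)))
∑ℕ-from (suc a) zero    g = refl
∑ℕ-from (suc a) (suc t) g = trans (sum-cong-≗ {t} shift) (∑ℕ-from a t (g ∘ suc))
  where
  shift : ∀ (i : Fin t) → 𝟙 (suc a ≤? suc (toℕ i)) * g (suc (toℕ i)) ≡ 𝟙 (a ≤? toℕ i) * g (suc (toℕ i))
  shift i = cong (_* g (suc (toℕ i))) (𝟙-⇔ (mk⇔ s≤s⁻¹ s≤s) (suc a ≤? suc (toℕ i)) (a ≤? toℕ i))

Interval? : ∀ a b i → Dec (a ≤ i × i < b)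
Interval? a b i = (a ≤? i) ×-dec (i <? b)

∑ℕ-interval : ∀ a b t (g : ℕ → ℕ) →
              ∑ℕ[ i < t ] (𝟙 (Interval? a b i) * g i) ≡ ∑ℕ[ i < b ⊓ t ∸ a ] g (a + i)
∑ℕ-interval a b t g = begin
  ∑ℕ[ i < t ] (𝟙 (Interval? a b i) * g i)             ≡⟨ sum-cong-≗ {t} (λ c → reorder (toℕ c)) ⟩
  ∑ℕ[ i < t ] (𝟙 (i <? b) * (𝟙 (a ≤? i) * g i))       ≡⟨ ∑ℕ-below b t (λ i → 𝟙 (a ≤? i) * g i) ⟩
  ∑ℕ[ i < b ⊓ t ] (𝟙 (a ≤? i) * g i)                   ≡⟨ ∑ℕ-from a (b ⊓ t) g ⟩
  ∑ℕ[ i < b ⊓ t ∸ a ] g (a + i)                      ∎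
  where
  reorder : ∀ i → 𝟙 (Interval? a b i) * g i ≡ 𝟙 (i <? b) * (𝟙 (a ≤? i) * g i)
  reorder i = begin
    𝟙 (Interval? a b i) * g i              ≡⟨ cong (_* g i) (𝟙-× (a ≤? i) (i <? b)) ⟩
    𝟙 (a ≤? i) * 𝟙 (i <? b) * g i          ≡⟨ cong (_* g i) (*-comm (𝟙 (a ≤? i)) _) ⟩
    𝟙 (i <? b) * 𝟙 (a ≤? i) * g i          ≡⟨ *-assoc (𝟙 (i <? b)) _ (g i) ⟩
    𝟙 (i <? b) * (𝟙 (a ≤? i) * g i)        ∎

Periodic : ℕ → (ℕ → ℕ) → Set
Periodic p g = ∀ x → g (x + p) ≡ g x

module _ {g : ℕ → ℕ} where

  ∑ℕ-window-step : ∀ p → Periodic p g → ∀ a → ∑ℕ[ i < p ] g (suc a + i) ≡ ∑ℕ[ i < p ] g (a + i)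
  ∑ℕ-window-step zero    _        a = refl
  ∑ℕ-window-step (suc q) periodic a = begin
    ∑ℕ[ i < suc q ] g (suc a + i)
      ≡⟨ ∑ℕ-snoc q (λ i → g (suc a + i)) ⟩
    ∑ℕ[ i < q ] g (suc a + i) + g (suc a + q)
      ≡⟨ cong₂ _+_ (sum-cong-≗ {q} (λ i → cong g (sym (+-suc a (toℕ i)))))
                   (trans (cong g (sym (+-suc a q))) (periodic a)) ⟩
    ∑ℕ[ i < q ] g (a + suc i) + g a
      ≡⟨ +-comm _ (g a) ⟩
    g a + ∑ℕ[ i < q ] g (a + suc i)
      ≡⟨ cong (λ x → g x + ∑ℕ[ i < q ] g (a + suc i)) (sym (+-identityʳ a)) ⟩
    ∑ℕ[ i < suc q ] g (a + i) ∎

  ∑ℕ-window : ∀ p → Periodic p g → ∀ a → ∑ℕ[ i < p ] g (a + i) ≡ ∑ℕ[ i < p ] g i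
  ∑ℕ-window p periodic zero    = refl
  ∑ℕ-window p periodic (suc a) = trans (∑ℕ-window-step p periodic a) (∑ℕ-window p periodic a)

  ∑ℕ-periods : ∀ p → Periodic p g → ∀ j a → ∑ℕ[ i < j * p ] g (a + i) ≡ j * ∑ℕ[ i < p ] g i
  ∑ℕ-periods p periodic zero    a = refl
  ∑ℕ-periods p periodic (suc j) a = begin
    ∑ℕ[ i < p + j * p ] g (a + i)
      ≡⟨ ∑ℕ-+ p (j * p) (λ i → g (a + i)) ⟩
    ∑ℕ[ i < p ] g (a + i) + ∑ℕ[ i < j * p ] g (a + (p + i))
      ≡⟨ cong₂ _+_ (∑ℕ-window p periodic a) (sum-cong-≗ {j * p} (λ i → cong g (sym (+-assoc a p _)))) ⟩
    ∑ℕ[ i < p ] g i + ∑ℕ[ i < j * p ] g (a + p + i)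
      ≡⟨ cong (_ +_) (∑ℕ-periods p periodic j (a + p)) ⟩
    ∑ℕ[ i < p ] g i + j * ∑ℕ[ i < p ] g i ∎

𝟙∣-periodic : ∀ d → Periodic d (λ x → 𝟙 (d ∣? x))
𝟙∣-periodic d x = 𝟙-⇔ (mk⇔ (λ d∣x+d → ∣m+n∣m⇒∣n (subst (d ∣_) (+-comm x d) d∣x+d) ∣-refl)
                           (λ d∣x → ∣m∣n⇒∣m+n d∣x ∣-refl))
                      (d ∣? x + d) (d ∣? x)

∑ℕ-multiples-window : ∀ d .{{_ : NonZero d}} → ∑ℕ[ i < d ] 𝟙 (d ∣? i) ≡ 1
∑ℕ-multiples-window (suc d) = cong₂ _+_ (𝟙-yes (suc d ∣? 0) (suc d ∣0))
                                         (trans (∑ℕ-cong< d none) (sum-replicate-zero d))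
  where
  none : ∀ i → i < d → 𝟙 (suc d ∣? suc i) ≡ 0
  none i i<d = 𝟙-no (suc d ∣? suc i) (λ d∣i → <-irrefl refl (<-≤-trans (s<s i<d) (∣⇒≤ d∣i)))

∑ℕ-multiples : ∀ d .{{_ : NonZero d}} j a → ∑ℕ[ i < j * d ] 𝟙 (d ∣? a + i) ≡ j
∑ℕ-multiples d j a = begin
  ∑ℕ[ i < j * d ] 𝟙 (d ∣? a + i)   ≡⟨ ∑ℕ-periods d (𝟙∣-periodic d) j a ⟩
  j * ∑ℕ[ i < d ] 𝟙 (d ∣? i)       ≡⟨ cong (j *_) (∑ℕ-multiples-window d) ⟩
  j * 1                            ≡⟨ *-identityʳ j ⟩
  j                                ∎

-- Multisets of colours, given by their multiplicity w c of each colour c < t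

module _ (d : ℕ) .{{_ : NonZero d}} (t : ℕ) where

  size : (Fin t → ℕ) → ℕ
  size w = ∑[ c < t ] w c

  multiples : (Fin t → ℕ) → ℕ
  multiples w = ∑[ c < t ] (w c * 𝟙 (d ∣? toℕ c))

  Balanced : (Fin t → ℕ) → Set
  Balanced w = d ∣ size w → d * multiples w ≡ size w

  interval-balanced : ∀ {w} a b → (∀ c → w c ≡ 𝟙 (Interval? a b (toℕ c))) → Balanced w
  interval-balanced {w} a b w≡ d∣size = begin
    d * multiples w                         ≡⟨ cong (d *_) multiples≡ ⟩
    d * ∑ℕ[ i < l ] 𝟙 (d ∣? a + i)          ≡⟨ cong (λ n → d * ∑ℕ[ i < n ] 𝟙 (d ∣? a + i)) l≡jd ⟩
    d * ∑ℕ[ i < j * d ] 𝟙 (d ∣? a + i)      ≡⟨ cong (d *_) (∑ℕ-multiples d j a) ⟩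
    d * j                                   ≡⟨ *-comm d j ⟩
    j * d                                   ≡⟨ sym l≡jd ⟩
    l                                       ≡⟨ sym size≡l ⟩
    size w                                  ∎
    where
    l : ℕ
    l = b ⊓ t ∸ a

    multiples≡ : multiples w ≡ ∑ℕ[ i < l ] 𝟙 (d ∣? a + i)
    multiples≡ = trans (sum-cong-≗ {t} (λ c → cong (_* 𝟙 (d ∣? toℕ c)) (w≡ c)))
                       (∑ℕ-interval a b t (λ i → 𝟙 (d ∣? i)))

    size≡l : size w ≡ l
    size≡l = begin
      ∑[ c < t ] w c                              ≡⟨ sum-cong-≗ {t} (λ c → trans (w≡ c) (sym (*-identityʳ _))) ⟩
      ∑ℕ[ i < t ] (𝟙 (Interval? a b i) * 1)        ≡⟨ ∑ℕ-interval a b t _ ⟩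
      ∑ℕ[ i < l ] 1                               ≡⟨ ∑-const-1 l ⟩
      l                                           ∎

    open _∣_ (subst (d ∣_) size≡l d∣size) renaming (quotient to j; equality to l≡jd)

  -- The whole palette is balanced when d ∣ t, and both size and multiples are additive.
  complement-balanced : d ∣ t → ∀ {w w′} → (∀ c → w c + w′ c ≡ 1) → Balanced w → Balanced w′
  complement-balanced (divides k t≡kd) {w} {w′} w+w′≡1 balanced d∣size′ =
    +-cancelˡ-≡ (d * multiples w) _ _ (begin
      d * multiples w + d * multiples w′   ≡⟨ sym (*-distribˡ-+ d _ _) ⟩
      d * (multiples w + multiples w′)     ≡⟨ cong (d *_) multiples-total ⟩
      d * k                                ≡⟨ trans (*-comm d k) (sym t≡kd) ⟩
      t                                    ≡⟨ sym size-total ⟩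
      size w + size w′                     ≡⟨ cong (_+ size w′) (sym (balanced d∣size)) ⟩
      d * multiples w + size w′            ∎)
    where
    size-total : size w + size w′ ≡ t
    size-total = trans (sym (∑-distrib-+ w w′)) (trans (sum-cong-≗ w+w′≡1) (∑-const-1 t))

    d∣size : d ∣ size w
    d∣size = ∣m+n∣m⇒∣n (subst (d ∣_) (trans (sym size-total) (+-comm (size w) (size w′))) (divides k t≡kd))
                       d∣size′

    multiples-total : multiples w + multiples w′ ≡ k
    multiples-total = begin
      multiples w + multiples w′
        ≡⟨ sym (∑-distrib-+ (λ c → w c * 𝟙 (d ∣? toℕ c)) (λ c → w′ c * 𝟙 (d ∣? toℕ c))) ⟩
      ∑[ c < t ] (w c * 𝟙 (d ∣? toℕ c) + w′ c * 𝟙 (d ∣? toℕ c))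
        ≡⟨ sum-cong-≗ {t} (λ c → trans (sym (*-distribʳ-+ _ (w c) (w′ c)))
                                       (trans (cong (_* 𝟙 (d ∣? toℕ c)) (w+w′≡1 c)) (+-identityʳ _))) ⟩
      ∑ℕ[ i < t ] 𝟙 (d ∣? i)
        ≡⟨ cong (λ n → ∑ℕ[ i < n ] 𝟙 (d ∣? i)) t≡kd ⟩
      ∑ℕ[ i < k * d ] 𝟙 (d ∣? i)
        ≡⟨ ∑ℕ-multiples d k 0 ⟩
      k ∎

module _ (G : Graph) where

  incident? : ∀ e v → Dec (Incident G e v)
  incident? e v = (end₁ G e ≟ v) ⊎-dec (end₂ G e ≟ v)

  degree≡∑ : ∀ v → degree G v ≡ ∑[ e < m G ] (𝟙 (incident? e v) * 1)
  degree≡∑ v = trans (length-filter-tabulate (λ e → incident? e v) (m G) (λ e → e))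
                     (sum-cong-≗ {m G} (λ e → sym (*-identityʳ _)))

  handshake : ∀ (Q : E G → ℕ) → ∑[ v < n G ] ∑[ e < m G ] (𝟙 (incident? e v) * Q e) ≡ 2 * ∑[ e < m G ] Q e
  handshake Q = begin
    ∑[ v < n G ] ∑[ e < m G ] (𝟙 (incident? e v) * Q e) ≡⟨ ∑-comm (λ v e → 𝟙 (incident? e v) * Q e) ⟩
    ∑[ e < m G ] ∑[ v < n G ] (𝟙 (incident? e v) * Q e) ≡⟨ sum-cong-≗ endpoints ⟩
    ∑[ e < m G ] (Q e + Q e)                            ≡⟨ ∑-distrib-+ Q Q ⟩
    ∑Q + ∑Q                                             ≡⟨ cong (∑Q +_) (sym (+-identityʳ ∑Q)) ⟩
    2 * ∑Q                                              ∎
    where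
    ∑Q : ℕ
    ∑Q = ∑[ e < m G ] Q e

    endpoints : ∀ e → ∑[ v < n G ] (𝟙 (incident? e v) * Q e) ≡ Q e + Q e
    endpoints e = begin
      ∑[ v < n G ] (𝟙 (incident? e v) * Q e)
        ≡⟨ sum-cong-≗ {n G} (λ v → cong (_* Q e) (𝟙-⊎-disjoint not-loop (end₁ G e ≟ v) (end₂ G e ≟ v))) ⟩
      ∑[ v < n G ] ((𝟙 (end₁ G e ≟ v) + 𝟙 (end₂ G e ≟ v)) * Q e)
        ≡⟨ sum-cong-≗ {n G} (λ v → *-distribʳ-+ (Q e) (𝟙 (end₁ G e ≟ v)) (𝟙 (end₂ G e ≟ v))) ⟩
      ∑[ v < n G ] (𝟙 (end₁ G e ≟ v) * Q e + 𝟙 (end₂ G e ≟ v) * Q e)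
        ≡⟨ ∑-distrib-+ (λ v → 𝟙 (end₁ G e ≟ v) * Q e) (λ v → 𝟙 (end₂ G e ≟ v) * Q e) ⟩
      ∑[ v < n G ] (𝟙 (end₁ G e ≟ v) * Q e) + ∑[ v < n G ] (𝟙 (end₂ G e ≟ v) * Q e)
        ≡⟨ cong₂ _+_ (∑-δ (end₁ G e) (λ _ → Q e)) (∑-δ (end₂ G e) (λ _ → Q e)) ⟩
      Q e + Q e ∎
      where
      not-loop : ∀ {v} → ¬ (end₁ G e ≡ v × end₂ G e ≡ v)
      not-loop (e₁≡v , e₂≡v) = loopless G e (trans e₁≡v (sym e₂≡v))

  vertex-weights⇒edgeCount : ∀ d (Q : E G → ℕ) →
                             (∀ v → d * ∑[ e < m G ] (𝟙 (incident? e v) * Q e) ≡ degree G v) →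
                             d * ∑[ e < m G ] Q e ≡ edgeCount G
  vertex-weights⇒edgeCount d Q local = *-cancelˡ-≡ _ _ 2 (begin
    2 * (d * ∑[ e < m G ] Q e)                              ≡⟨ x*yz≡y*xz 2 d (∑[ e < m G ] Q e) ⟩
    d * (2 * ∑[ e < m G ] Q e)                              ≡⟨ cong (d *_) (sym (handshake Q)) ⟩
    d * ∑[ v < n G ] weight v                               ≡⟨ *-distribˡ-sum d weight ⟩
    ∑[ v < n G ] (d * weight v)                             ≡⟨ sum-cong-≗ local ⟩
    ∑[ v < n G ] degree G v                                 ≡⟨ sum-cong-≗ degree≡∑ ⟩
    ∑[ v < n G ] ∑[ e < m G ] (𝟙 (incident? e v) * 1)       ≡⟨ handshake (λ _ → 1) ⟩
    2 * ∑[ e < m G ] 1                                      ≡⟨ cong (2 *_) (∑-const-1 (m G)) ⟩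
    2 * m G                                                 ∎)
    where
    weight : V G → ℕ
    weight v = ∑[ e < m G ] (𝟙 (incident? e v) * Q e)

  module _ {t} (α : EdgeColoring G t) where

    multiplicity : V G → Fin t → ℕ
    multiplicity v c = ∑[ e < m G ] (𝟙 (incident? e v) * 𝟙 (α e ≟ c))

    ∑-at-vertex : ∀ v (h : Fin t → ℕ) →
                  ∑[ e < m G ] (𝟙 (incident? e v) * h (α e)) ≡ ∑[ c < t ] (multiplicity v c * h c)
    ∑-at-vertex v = ∑-fibres α (λ e → 𝟙 (incident? e v))

    inS? : ∀ v c → Dec (InS G t α v c)
    inS? v c = any? (λ e → incident? e v ×-dec (α e ≟ c))

    multiplicity-proper : Proper G t α → ∀ v c → multiplicity v c ≡ 𝟙 (inS? v c)
    multiplicity-proper proper v c = begin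
      ∑[ e < m G ] (𝟙 (incident? e v) * 𝟙 (α e ≟ c))
        ≡⟨ sum-cong-≗ {m G} (λ e → sym (𝟙-× (incident? e v) (α e ≟ c))) ⟩
      ∑[ e < m G ] 𝟙 (incident? e v ×-dec α e ≟ c)
        ≡⟨ ∑-𝟙-unique _ unique ⟩
      𝟙 (inS? v c) ∎
      where
      unique : ∀ e e′ → Incident G e v × α e ≡ c → Incident G e′ v × α e′ ≡ c → e ≡ e′
      unique e e′ (ie , αe) (ie′ , αe′) with e ≟ e′
      ... | yes e≡e′ = e≡e′
      ... | no e≢e′  = ⊥-elim (proper e e′ (e≢e′ , v , ie , ie′) (trans αe (sym αe′)))

    cyclicInterval-balanced : ∀ d .{{_ : NonZero d}} → d ∣ t → CyclicInterval G t α →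
                              ∀ v → Balanced d t (multiplicity v)
    cyclicInterval-balanced d d∣t (proper , cyclic) v with cyclic v
    ... | inj₁ (a , b , inS⇔) = interval-balanced d t a b is-interval
      where
      is-interval : ∀ c → multiplicity v c ≡ 𝟙 (Interval? a b (toℕ c))
      is-interval c = trans (multiplicity-proper proper v c) (𝟙-⇔ (inS⇔ c) (inS? v c) (Interval? a b (toℕ c)))
    ... | inj₂ (a , b , ¬inS⇔) =
      complement-balanced d t d∣t complementary (interval-balanced d t a b (λ _ → refl))
      where
      complementary : ∀ c → 𝟙 (Interval? a b (toℕ c)) + multiplicity v c ≡ 1
      complementary c = begin
        𝟙 (Interval? a b (toℕ c)) + multiplicity v c
          ≡⟨ cong₂ _+_ (𝟙-⇔ (⇔.sym (¬inS⇔ c)) (Interval? a b (toℕ c)) (¬? (inS? v c)))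
                       (multiplicity-proper proper v c) ⟩
        𝟙 (¬? (inS? v c)) + 𝟙 (inS? v c)
          ≡⟨ +-comm (𝟙 (¬? (inS? v c))) (𝟙 (inS? v c)) ⟩
        𝟙 (inS? v c) + 𝟙 (¬? (inS? v c))
          ≡⟨ 𝟙-¬ (inS? v c) ⟩
        1 ∎

    multiples-at-vertex : ∀ d .{{_ : NonZero d}} → d ∣ t → CyclicInterval G t α → ∀ v → d ∣ degree G v →
                          d * ∑[ e < m G ] (𝟙 (incident? e v) * 𝟙 (d ∣? toℕ (α e))) ≡ degree G v
    multiples-at-vertex d d∣t cyclic v d∣deg = begin
      d * ∑[ e < m G ] (𝟙 (incident? e v) * 𝟙 (d ∣? toℕ (α e)))  ≡⟨ cong (d *_) (∑-at-vertex v _) ⟩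
      d * multiples d t (multiplicity v)                         ≡⟨ balanced (subst (d ∣_) deg≡size d∣deg) ⟩
      size d t (multiplicity v)                                  ≡⟨ sym deg≡size ⟩
      degree G v                                                 ∎
      where
      balanced : Balanced d t (multiplicity v)
      balanced = cyclicInterval-balanced d d∣t cyclic v

      deg≡size : degree G v ≡ size d t (multiplicity v)
      deg≡size = begin
        degree G v                             ≡⟨ degree≡∑ v ⟩
        ∑[ e < m G ] (𝟙 (incident? e v) * 1)   ≡⟨ ∑-at-vertex v (λ _ → 1) ⟩
        ∑[ c < t ] (multiplicity v c * 1)      ≡⟨ sum-cong-≗ {t} (λ c → *-identityʳ _) ⟩
        size d t (multiplicity v)              ∎

theorem7 : (G : Graph) (d : ℕ) → 1 ≤ d → (∀ v → d ∣ degree G v) → ¬ (d ∣ edgeCount G) →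
    (k : ℕ) → 1 ≤ k → (α : EdgeColoring G (d * k)) → ¬ CyclicInterval G (d * k) α
theorem7 G d@(suc _) _ d∣degree d∤edgeCount k _ α cyclic =
  d∤edgeCount (divides multipleEdges (trans (sym (vertex-weights⇒edgeCount G d _ local)) (*-comm d _)))
  where
  multipleEdges : ℕ
  multipleEdges = ∑[ e < m G ] 𝟙 (d ∣? toℕ (α e))

  local : ∀ v → d * ∑[ e < m G ] (𝟙 (incident? G e v) * 𝟙 (d ∣? toℕ (α e))) ≡ degree G v
  local v = multiples-at-vertex G α d (divides k (*-comm d k)) cyclic v (d∣degree v)
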